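{- Let $n\in\overline{C_2}$ and let $G_n$ be the set of units of $\mathbb{Z}_n$. Then $G_n$ admits a cardioidal partition $A$ in $\mathbb{Z}_n\setminus\{0\}$ such that $\Delta A=G_n$.
   Context: $C_2$ is the set of (odd) primes $p$ such that the multiplicative order of $2$ modulo $p$ is $\equiv2\pmod4$; $\overline{C_2}$ is the set of all products of one or more (not necessarily distinct) primes from $C_2$. For odd $n\ge3$, a cardioidal pair is a pair $\{i,2i\bmod n\}$ with $i\in\mathbb{Z}_n\setminus\{0\}$; a cardioidal partition of a set $X\subset\mathbb{Z}_n\setminus\{0\}$ is a partition of $X$ into cardioidal pairs. For a set $A=\{\{x_i,y_i\}\}_{i=1}^k$ of pairs of residues modulo $n$, $\Delta A=\{\pm(x_i-y_i)\bmod n\}_{i=1}^k$. -}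

module Defs where

open import Data.Nat using (ℕ; zero; suc; _+_; _*_; _∸_; _^_; _<_; NonZero)
open import Data.Nat.DivMod using (_%_)
open import Data.Nat.Divisibility using (_∣_)
open import Data.Nat.Primality using (Prime)
open import Data.Nat.Coprimality using (Coprime)
open import Data.List using (List; []; _∷_; concatMap)
open import Data.List.Membership.Propositional using (_∈_)
open import Data.List.Relation.Unary.All using (All)
open import Data.List.Relation.Unary.Unique.Propositional using (Unique)
open import Data.Product using (_×_; ∃-syntax)
open import Relation.Nullary using (¬_)
open import Relation.Binary.PropositionalEquality using (_≡_; _≢_)
open import Function.Bundles using (_⇔_)

IsOrderMod : (a p k : ℕ) → .{{NonZero p}} → Set
IsOrderMod a p k =
  (0 < k) × ((a ^ k) % p ≡ 1) × (∀ j → 0 < j → j < k → (a ^ j) % p ≢ 1)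

InC₂ : ℕ → Set
InC₂ zero = Prime zero   -- uninhabited (0 is not prime)
InC₂ p@(suc _) = Prime p × ¬ (2 ∣ p) × ∃[ k ] (IsOrderMod 2 p k × k % 4 ≡ 2)

data InC̄₂ : ℕ → Set where
  single : ∀ {p} → InC₂ p → InC̄₂ p
  times  : ∀ {p m} → InC₂ p → InC̄₂ m → InC̄₂ (p * m)

IsUnit : ℕ → ℕ → Set
IsUnit n x = (x < n) × Coprime x n

-- a list of i's encodes the family of cardioidal pairs {i, 2i mod n}
module _ (n : ℕ) .{{_ : NonZero n}} where

  pairElems : ℕ → List ℕ
  pairElems i = i ∷ (2 * i) % n ∷ []

  elems : List ℕ → List ℕ
  elems A = concatMap pairElems A

  AreCardioidal : List ℕ → Set
  AreCardioidal A = All (λ i → (0 < i) × (i < n)) A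

  -- A is a cardioidal partition of the set X ⊆ ℤ_n ∖ {0}:
  -- the pairs are disjoint (elements listed without repetition) and cover exactly X
  IsCardioidalPartition : (ℕ → Set) → List ℕ → Set
  IsCardioidalPartition X A =
    AreCardioidal A × Unique (elems A) × (∀ x → (x ∈ elems A ⇔ X x))

  -- ΔA = { ±(x - y) mod n : {x,y} ∈ A }
  diffs : ℕ → List ℕ
  diffs i = (i + n ∸ (2 * i) % n) % n ∷ ((2 * i) % n + n ∸ i) % n ∷ []

  Δ : List ℕ → List ℕ
  Δ A = concatMap diffs A

-- Every n ∈ C̄₂ divides 2 ^ e + 1 for some odd e: for p ∈ C₂ take e = ord_p(2) / 2, and the
-- property passes to products by lifting the exponent, as y ^ p + 1 ≡ p (y + 1) modulo (y + 1)²
-- for odd p. So 2 ^ e ≡ -1 (mod n), doubling permutes the units with period 2e, and 2 ^ i x ≢ 2 ^ j x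
-- for a unit x when i and j have different parities (raise both sides to the e-th power).
-- Colour a unit by the parity of the step at which its doubling orbit attains its least element.
-- Doubling swaps the colours, so the pairs {x, 2x} with x of the first colour partition the units,
-- and so do their differences ∓x, because -x = 2 ^ e x has the colour opposite to x.

module Submission where

open import Defs
open import Data.Nat using (ℕ; NonZero)
open import Data.List using (List)
open import Data.List.Membership.Propositional using (_∈_)
open import Data.Product using (_×_; ∃-syntax)
open import Function.Bundles using (_⇔_)

open import Data.Nat using (zero; suc)
import Data.Nat as ℕ
import Data.Nat.Properties as ℕ
import Data.Nat.Divisibility as ℕ
open import Data.List using ([]; _∷_)
open import Data.Product using (_,_)
open import Relation.Binary.PropositionalEquality

Odd : ℕ → Set
Odd t = ∃[ k ] t ≡ suc (k ℕ.+ k)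

infix 4 _∣2^odd+1
_∣2^odd+1 : ℕ → Set
n ∣2^odd+1 = ∃[ e ] Odd e × n ℕ.∣ 2 ℕ.^ e ℕ.+ 1

odd-* : ∀ {a b} → Odd a → Odd b → Odd (a ℕ.* b)
odd-* (i , refl) (j , refl) = i ℕ.+ j ℕ.+ 2 ℕ.* i ℕ.* j , solve (i ∷ j ∷ [])
  where open import Data.Nat.Tactic.RingSolver using (solve)

module _ where
  open import Data.Integer using (+_; -_; _+_; _-_; _*_; _^_; 1ℤ)
  open import Data.Integer.Properties using (pos-*; ^-*-assoc)
  open import Data.Integer.Divisibility.Signed
  open import Data.Integer.Tactic.RingSolver using (solve-∀; solve)

  pos-^ : ∀ a j → + (a ℕ.^ j) ≡ (+ a) ^ j
  pos-^ a zero    = refl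
  pos-^ a (suc j) = trans (pos-* a (a ℕ.^ j)) (cong (+ a *_) (pos-^ a j))

  -- The binomial expansion of (1 - M) ^ j to first order, with M = y + 1, so that - y = 1 - M.
  neg-power-expansion : ∀ y j → (y + 1ℤ) * (y + 1ℤ) ∣ (- y) ^ j - (1ℤ - + j * (y + 1ℤ))
  neg-power-expansion y zero    = divides (+ 0) (solve (y ∷ []))
  neg-power-expansion y (suc j) =
    subst (M * M ∣_) (step y ((- y) ^ j) (+ j))
      (∣m∣n⇒∣m+n (∣n⇒∣m*n (- y) (neg-power-expansion y j)) (∣n⇒∣m*n (+ j) ∣-refl))
    where
    M = y + 1ℤ
    step : ∀ y X J → (- y) * (X - (1ℤ - J * (y + 1ℤ))) + J * ((y + 1ℤ) * (y + 1ℤ))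
                   ≡ (- y) * X - (1ℤ - (1ℤ + J) * (y + 1ℤ))
    step = solve-∀

  neg-^-odd : ∀ y k → (- y) ^ suc (k ℕ.+ k) ≡ - (y ^ suc (k ℕ.+ k))
  neg-^-odd y zero    = base y
    where
    base : ∀ y → (- y) * 1ℤ ≡ - (y * 1ℤ)
    base = solve-∀
  neg-^-odd y (suc k) rewrite ℕ.+-suc k k =
    trans (cong (λ z → (- y) * ((- y) * z)) (neg-^-odd y k)) (step y (y ^ suc (k ℕ.+ k)))
    where
    step : ∀ y Z → (- y) * ((- y) * (- Z)) ≡ - (y * (y * Z))
    step = solve-∀

  odd-power-expansion : ∀ y {t} → Odd t → (y + 1ℤ) * (y + 1ℤ) ∣ y ^ t + 1ℤ - + t * (y + 1ℤ)
  odd-power-expansion y {t} (k , refl) =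
    subst ((y + 1ℤ) * (y + 1ℤ) ∣_) negate (∣m⇒∣-m (neg-power-expansion y t))
    where
    flip : ∀ Y T M → - (- Y - (1ℤ - T * M)) ≡ Y + 1ℤ - T * M
    flip = solve-∀
    negate : - ((- y) ^ t - (1ℤ - + t * (y + 1ℤ))) ≡ y ^ t + 1ℤ - + t * (y + 1ℤ)
    negate = trans (cong (λ z → - (z - (1ℤ - + t * (y + 1ℤ)))) (neg-^-odd y k))
                   (flip (y ^ t) (+ t) (y + 1ℤ))

  m-n+n≡m : ∀ a b → a - b + b ≡ a
  m-n+n≡m = solve-∀

  ∣-odd-power : ∀ {N y t} → Odd t → N ∣ y + 1ℤ → N ∣ y ^ t + 1ℤ
  ∣-odd-power {N} {y} {t} odd N∣M = subst (N ∣_) (m-n+n≡m (y ^ t + 1ℤ) (+ t * (y + 1ℤ)))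
    (∣m∣n⇒∣m+n (∣-trans N∣M (∣-trans (∣m⇒∣m*n (y + 1ℤ) ∣-refl) (odd-power-expansion y odd)))
               (∣n⇒∣m*n (+ t) N∣M))

  -- y ^ p + 1 ≡ p (y + 1) modulo (y + 1)², and p m divides both (y + 1)² and p (y + 1).
  ∣-odd-power-lift : ∀ {p m y} → Odd p → + p ∣ y + 1ℤ → + m ∣ y + 1ℤ → + (p ℕ.* m) ∣ y ^ p + 1ℤ
  ∣-odd-power-lift {p} {m} {y} odd p∣M m∣M = subst₂ _∣_ (sym (pos-* p m)) (m-n+n≡m (y ^ p + 1ℤ) (+ p * M))
    (∣m∣n⇒∣m+n (∣-trans (∣-trans (*-monoˡ-∣ (+ m) p∣M) (*-monoʳ-∣ M m∣M)) (odd-power-expansion y odd))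
               (*-monoʳ-∣ (+ p) m∣M))
    where M = y + 1ℤ

  ∣2^e+1⇒ℤ : ∀ {n} e → n ℕ.∣ 2 ℕ.^ e ℕ.+ 1 → + n ∣ (+ 2) ^ e + 1ℤ
  ∣2^e+1⇒ℤ {n} e n∣ = subst (λ z → + n ∣ z + 1ℤ) (pos-^ 2 e) (∣ᵤ⇒∣ n∣)

  ℤ⇒∣2^e+1 : ∀ {n} e → + n ∣ (+ 2) ^ e + 1ℤ → n ℕ.∣ 2 ℕ.^ e ℕ.+ 1
  ℤ⇒∣2^e+1 {n} e n∣ = ∣⇒∣ᵤ (subst (λ z → + n ∣ z + 1ℤ) (sym (pos-^ 2 e)) n∣)

  ∣2^odd+1-* : ∀ {p m} → Odd p → p ∣2^odd+1 → m ∣2^odd+1 → p ℕ.* m ∣2^odd+1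
  ∣2^odd+1-* {p} {m} odd-p (a , odd-a , p∣) (b , odd-b , m∣) =
    a ℕ.* b ℕ.* p , odd-* (odd-* odd-a odd-b) odd-p ,
    ℤ⇒∣2^e+1 (a ℕ.* b ℕ.* p) (subst (λ z → + (p ℕ.* m) ∣ z + 1ℤ) (^-*-assoc (+ 2) (a ℕ.* b) p)
      (∣-odd-power-lift odd-p p∣Y+1 m∣Y+1))
    where
    p∣Y+1 : + p ∣ (+ 2) ^ (a ℕ.* b) + 1ℤ
    p∣Y+1 = subst (λ z → + p ∣ z + 1ℤ) (^-*-assoc (+ 2) a b) (∣-odd-power odd-b (∣2^e+1⇒ℤ a p∣))
    m∣Y+1 : + m ∣ (+ 2) ^ (a ℕ.* b) + 1ℤ
    m∣Y+1 = subst (λ z → + m ∣ z + 1ℤ) (trans (^-*-assoc (+ 2) b a) (cong ((+ 2) ^_) (ℕ.*-comm b a)))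
              (∣-odd-power odd-a (∣2^e+1⇒ℤ b m∣))

open import Data.Nat
open import Data.Nat.Properties
open import Data.Nat.DivMod
  using (_%_; _/_; %-distribˡ-+; %-distribˡ-*; m%n%n≡m%n; %-remove-+ˡ; %-remove-+ʳ; m%n<n; m%n≤n; n%n≡0;
         [m+n]%n≡m%n; m<n⇒m%n≡m; m≡m%n+[m/n]*n)
open import Data.Nat.Divisibility
open import Data.Nat.Coprimality using (Coprime; coprime?; coprime-factors; 1-coprimeTo; 0-coprimeTo-m⇒m≡1)
open import Data.Nat.Primality using (Prime; euclidsLemma; prime⇒nonTrivial)
open import Data.Nat.GeneralisedArithmetic using (iterate)
open import Data.Nat.Tactic.RingSolver using (solve-∀)
open import Data.List using (concatMap; filter; upTo)
open import Data.List.Membership.Propositional using (find; lose)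
open import Data.List.Membership.Propositional.Properties
  using (∈-concatMap⁺; ∈-concatMap⁻; ∈-filter⁺; ∈-filter⁻; ∈-upTo⁺)
open import Data.List.Relation.Unary.Any using (here; there)
import Data.List.Relation.Unary.All as All
open import Data.List.Relation.Unary.AllPairs using ([]; _∷_)
open import Data.List.Relation.Unary.Unique.Propositional using (Unique)
open import Data.List.Relation.Unary.Unique.Propositional.Properties using (filter⁺; upTo⁺)
open import Data.Product using (proj₁; proj₂)
open import Data.Sum using (_⊎_; inj₁; inj₂)
import Data.Sum as Sum
open import Data.Empty using (⊥-elim)
open import Function using (id; _∘_)
open import Function.Bundles using (mk⇔)
open import Relation.Nullary using (¬_; Dec; yes; no)
open import Relation.Nullary.Decidable using (map′; _×-dec_)
open import Relation.Unary using (Decidable)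

infix 4 _≡_mod_
_≡_mod_ : ℕ → ℕ → (n : ℕ) .{{_ : NonZero n}} → Set
a ≡ b mod n = a % n ≡ b % n

module _ {n : ℕ} .{{_ : NonZero n}} where

  +-cong-mod : ∀ {a b c d} → a ≡ b mod n → c ≡ d mod n → a + c ≡ b + d mod n
  +-cong-mod {a} {b} {c} {d} a≡b c≡d = begin
    (a + c) % n         ≡⟨ %-distribˡ-+ a c n ⟩
    (a % n + c % n) % n ≡⟨ cong₂ (λ u v → (u + v) % n) a≡b c≡d ⟩
    (b % n + d % n) % n ≡⟨ %-distribˡ-+ b d n ⟨
    (b + d) % n         ∎
    where open ≡-Reasoning

  *-cong-mod : ∀ {a b c d} → a ≡ b mod n → c ≡ d mod n → a * c ≡ b * d mod n
  *-cong-mod {a} {b} {c} {d} a≡b c≡d = begin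
    (a * c) % n           ≡⟨ %-distribˡ-* a c n ⟩
    (a % n * (c % n)) % n ≡⟨ cong₂ (λ u v → (u * v) % n) a≡b c≡d ⟩
    (b % n * (d % n)) % n ≡⟨ %-distribˡ-* b d n ⟨
    (b * d) % n           ∎
    where open ≡-Reasoning

  ^-cong-mod : ∀ {a b} → a ≡ b mod n → ∀ j → a ^ j ≡ b ^ j mod n
  ^-cong-mod a≡b zero    = refl
  ^-cong-mod a≡b (suc j) = *-cong-mod a≡b (^-cong-mod a≡b j)

  %-mod : ∀ a → a % n ≡ a mod n
  %-mod a = m%n%n≡m%n a n

  +-cancelʳ-mod : ∀ {a b} c → a + c ≡ b + c mod n → a ≡ b mod n
  +-cancelʳ-mod {a} {b} c eq = begin
    a % n              ≡⟨ %-remove-+ʳ a n∣c+c′ ⟨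
    (a + (c + c′)) % n ≡⟨ cong (_% n) (+-assoc a c c′) ⟨
    (a + c + c′) % n   ≡⟨ +-cong-mod eq refl ⟩
    (b + c + c′) % n   ≡⟨ cong (_% n) (+-assoc b c c′) ⟩
    (b + (c + c′)) % n ≡⟨ %-remove-+ʳ b n∣c+c′ ⟩
    b % n              ∎
    where
    open ≡-Reasoning
    c′ = n ∸ c % n
    n∣c+c′ : n ∣ c + c′
    n∣c+c′ = m%n≡0⇒n∣m (c + c′) n (begin
      (c + c′) % n     ≡⟨ +-cong-mod (%-mod c) refl ⟨
      (c % n + c′) % n ≡⟨ cong (_% n) (m+[n∸m]≡n (m%n≤n c n)) ⟩
      n % n            ≡⟨ n%n≡0 n ⟩
      0                ∎)

  mod-injective : ∀ {a b} → a < n → b < n → a ≡ b mod n → a ≡ b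
  mod-injective {a} {b} a<n b<n eq = begin
    a     ≡⟨ m<n⇒m%n≡m a<n ⟨
    a % n ≡⟨ eq ⟩
    b % n ≡⟨ m<n⇒m%n≡m b<n ⟩
    b     ∎
    where open ≡-Reasoning

  ∣-resp-mod : ∀ {a b} → a ≡ b mod n → n ∣ b → n ∣ a
  ∣-resp-mod {a} {b} a≡b n∣b = m%n≡0⇒n∣m a n (trans a≡b (n∣m⇒m%n≡0 b n n∣b))

  ∣⇒≡-mod : ∀ {a b} → n ∣ a → n ∣ b → a ≡ b mod n
  ∣⇒≡-mod {a} {b} n∣a n∣b = trans (n∣m⇒m%n≡0 a n n∣a) (sym (n∣m⇒m%n≡0 b n n∣b))

  *-congˡ-mod : ∀ a {b c} → b ≡ c mod n → a * b ≡ a * c mod n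
  *-congˡ-mod a = *-cong-mod {a} {a} refl

coprime-* : ∀ {a b n} → Coprime a n → Coprime b n → Coprime (a * b) n
coprime-* {a} {b} {n} a⊥n b⊥n (d∣ab , d∣n) =
  b⊥n (coprime-factors a⊥n (d∣ab , ∣m⇒∣m*n b d∣n) , d∣n)

coprime-^ : ∀ {a n} → Coprime a n → ∀ j → Coprime (a ^ j) n
coprime-^ {n = n} a⊥n zero    = 1-coprimeTo n
coprime-^         a⊥n (suc j) = coprime-* a⊥n (coprime-^ a⊥n j)

coprime-% : ∀ {a n} .{{_ : NonZero n}} → Coprime a n → Coprime (a % n) n
coprime-% a⊥n (d∣a%n , d∣n) = a⊥n (∣n∣m%n⇒∣m d∣n d∣a%n , d∣n)

even⊎odd : ∀ j → ∃[ i ] (j ≡ i + i ⊎ j ≡ suc (i + i))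
even⊎odd zero = 0 , inj₁ refl
even⊎odd (suc j) with even⊎odd j
... | i , inj₁ refl = i , inj₂ refl
... | i , inj₂ refl = suc i , inj₁ (cong suc (sym (+-suc i i)))

¬2∣⇒odd : ∀ {n} → ¬ 2 ∣ n → Odd n
¬2∣⇒odd {n} ¬2∣n with even⊎odd n
... | i , inj₂ n≡    = i , n≡
... | i , inj₁ n≡i+i = ⊥-elim (¬2∣n (divides i (trans n≡i+i (i+i≡i*2 i))))
  where
  i+i≡i*2 : ∀ i → i + i ≡ i * 2
  i+i≡i*2 = solve-∀

prime⇒1< : ∀ {p} → Prime p → 1 < p
prime⇒1< {p} p-prime = nonTrivial⇒n>1 p {{prime⇒nonTrivial p-prime}}

-- A prime p divides (x - 1)(x + 1) whenever x² ≡ 1.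
square≡1⇒≡±1 : ∀ {p x} .{{_ : NonZero p}} → Prime p → 0 < x → x * x ≡ 1 mod p →
               x ≡ 1 mod p ⊎ p ∣ x + 1
square≡1⇒≡±1 {p} {suc w} p-prime _ x²≡1 =
  Sum.map (%-remove-+ʳ 1) (subst (p ∣_) (+-suc w 1)) (euclidsLemma w (w + 2) p-prime p∣w[w+2])
  where
  expand : ∀ w → suc w * suc w ≡ w * (w + 2) + 1
  expand = solve-∀
  p∣w[w+2] : p ∣ w * (w + 2)
  p∣w[w+2] = ∣-resp-mod (+-cancelʳ-mod 1 (trans (cong (_% p) (sym (expand w))) x²≡1)) (p ∣0)

-- ord_p 2 = 2h with h odd, and 2^h ≢ 1 by minimality of the order, so 2^h ≡ -1.
C₂⇒ : ∀ {p} → InC₂ p → 1 < p × Odd p × p ∣2^odd+1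
C₂⇒ {zero} p-prime with prime⇒1< p-prime
... | ()
C₂⇒ {p@(suc _)} (p-prime , ¬2∣p , k , (_ , 2^k≡1 , minimal) , k%4≡2) =
  1<p , ¬2∣⇒odd ¬2∣p , h , (k / 4 , refl) , p∣2^h+1
  where
  1<p = prime⇒1< p-prime
  h = suc (k / 4 + k / 4)
  quarter : ∀ q → 2 + q * 4 ≡ suc (q + q) + suc (q + q)
  quarter = solve-∀
  k≡h+h : k ≡ h + h
  k≡h+h = trans (m≡m%n+[m/n]*n k 4) (trans (cong (_+ k / 4 * 4) k%4≡2) (quarter (k / 4)))
  h<k : h < k
  h<k = subst (h <_) (sym k≡h+h) (m<m+n h z<s)
  2^h*2^h≡1 : 2 ^ h * 2 ^ h ≡ 1 mod p
  2^h*2^h≡1 = begin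
    (2 ^ h * 2 ^ h) % p ≡⟨ cong (_% p) (^-distribˡ-+-* 2 h h) ⟨
    2 ^ (h + h) % p     ≡⟨ cong (λ j → 2 ^ j % p) k≡h+h ⟨
    2 ^ k % p           ≡⟨ 2^k≡1 ⟩
    1                   ≡⟨ m<n⇒m%n≡m 1<p ⟨
    1 % p               ∎
    where open ≡-Reasoning
  p∣2^h+1 : p ∣ 2 ^ h + 1
  p∣2^h+1 with square≡1⇒≡±1 p-prime (m^n>0 2 h) 2^h*2^h≡1
  ... | inj₁ 2^h≡1 = ⊥-elim (minimal h z<s h<k (trans 2^h≡1 (m<n⇒m%n≡m 1<p)))
  ... | inj₂ p∣    = p∣

C̄₂⇒ : ∀ {n} → InC̄₂ n → 1 < n × n ∣2^odd+1
C̄₂⇒ (single p∈C₂) = let 1<p , _ , p∣ = C₂⇒ p∈C₂ in 1<p , p∣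
C̄₂⇒ (times p∈C₂ m∈C̄₂) with C₂⇒ p∈C₂ | C̄₂⇒ m∈C̄₂
... | 1<p , odd-p , p∣ | 1<m , m∣ = *-mono-< 1<p 1<m , ∣2^odd+1-* odd-p p∣ m∣

minUpTo : (ℕ → ℕ) → ℕ → ℕ
minUpTo f zero    = f zero
minUpTo f (suc m) = minUpTo f m ⊓ f (suc m)

minUpTo-≤ : ∀ f {m j} → j ≤ m → minUpTo f m ≤ f j
minUpTo-≤ f {zero}  z≤n = ≤-refl
minUpTo-≤ f {suc m} j≤1+m with m≤n⇒m<n∨m≡n j≤1+m
... | inj₁ j<1+m = ≤-trans (m⊓n≤m _ _) (minUpTo-≤ f (s≤s⁻¹ j<1+m))
... | inj₂ refl  = m⊓n≤n _ _

minUpTo-attained : ∀ f m → ∃[ j ] j ≤ m × f j ≡ minUpTo f m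
minUpTo-attained f zero = 0 , z≤n , refl
minUpTo-attained f (suc m) with ⊓-sel (minUpTo f m) (f (suc m))
... | inj₂ min≡f = suc m , ≤-refl , sym min≡f
... | inj₁ min≡min with minUpTo-attained f m
...   | j , j≤m , fj≡ = j , m≤n⇒m≤1+n j≤m , trans fj≡ (sym min≡min)

-- f (suc m) ≡ f 0 makes f and f ∘ suc take the same values on [0, m].
minUpTo-rotate : ∀ f m → f (suc m) ≡ f 0 → minUpTo (f ∘ suc) m ≡ minUpTo f m
minUpTo-rotate f m periodic = ≤-antisym rotated≤ ≤rotated
  where
  rotated≤ : minUpTo (f ∘ suc) m ≤ minUpTo f m
  rotated≤ with minUpTo-attained f m
  ... | zero  , _   , f0≡ = ≤-trans (minUpTo-≤ (f ∘ suc) ≤-refl) (≤-reflexive (trans periodic f0≡))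
  ... | suc j , j<m , fj≡ = ≤-trans (minUpTo-≤ (f ∘ suc) (≤-trans (n≤1+n j) j<m)) (≤-reflexive fj≡)
  ≤rotated : minUpTo f m ≤ minUpTo (f ∘ suc) m
  ≤rotated with minUpTo-attained (f ∘ suc) m
  ... | j , j≤m , fj≡ with m≤n⇒m<n∨m≡n j≤m
  ...   | inj₁ j<m  = ≤-trans (minUpTo-≤ f j<m) (≤-reflexive fj≡)
  ...   | inj₂ refl = ≤-trans (minUpTo-≤ f {m} z≤n) (≤-reflexive (trans (sym periodic) fj≡))

MinAtEven : (ℕ → ℕ) → ℕ → Set
MinAtEven f m = ∃[ i ] i + i ≤ m × f (i + i) ≡ minUpTo f m

minAtEven? : ∀ f m → Dec (MinAtEven f m)
minAtEven? f m =
  map′ (λ (i , _ , P) → i , P) (λ (i , P) → i , s≤s (≤-trans (m≤m+n i i) (proj₁ P)) , P)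
       (anyUpTo? (λ i → (i + i ≤? m) ×-dec (f (i + i) ≟ minUpTo f m)) (suc m))

¬minAtEven⇒minAtEven∘suc : ∀ f m → f (suc m) ≡ f 0 → ¬ MinAtEven f m → MinAtEven (f ∘ suc) m
¬minAtEven⇒minAtEven∘suc f m periodic ¬even with minUpTo-attained f m
... | j , j≤m , fj≡ with even⊎odd j
...   | i , inj₁ refl = ⊥-elim (¬even (i , j≤m , fj≡))
...   | i , inj₂ refl = i , <⇒≤ j≤m , trans fj≡ (sym (minUpTo-rotate f m periodic))

minAtEven⇒¬minAtEven∘suc : ∀ f m → f (suc m) ≡ f 0 → (∀ i i′ → f (i + i) ≢ f (suc (i′ + i′))) →
                           MinAtEven f m → ¬ MinAtEven (f ∘ suc) m
minAtEven⇒¬minAtEven∘suc f m periodic separated (i , _ , fi≡) (i′ , _ , fi′≡) =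
  separated i i′ (trans fi≡ (trans (sym (minUpTo-rotate f m periodic)) (sym fi′≡)))

pairs : ∀ {A B : Set} → (A → B) → (A → B) → List A → List B
pairs f g = concatMap (λ x → f x ∷ g x ∷ [])

module _ {A B : Set} (f g : A → B) where

  ∈-pairs⁻ : ∀ {xs y} → y ∈ pairs f g xs → ∃[ x ] x ∈ xs × (y ≡ f x ⊎ y ≡ g x)
  ∈-pairs⁻ y∈ with find (∈-concatMap⁻ (λ x → f x ∷ g x ∷ []) y∈)
  ... | x , x∈ , here refl         = x , x∈ , inj₁ refl
  ... | x , x∈ , there (here refl) = x , x∈ , inj₂ refl

  ∈-pairs⁺ˡ : ∀ {xs x} → x ∈ xs → f x ∈ pairs f g xs
  ∈-pairs⁺ˡ {x = x} x∈ =
    ∈-concatMap⁺ (λ x → f x ∷ g x ∷ []) (lose {P = λ z → f x ∈ f z ∷ g z ∷ []} x∈ (here refl))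

  ∈-pairs⁺ʳ : ∀ {xs x} → x ∈ xs → g x ∈ pairs f g xs
  ∈-pairs⁺ʳ {x = x} x∈ =
    ∈-concatMap⁺ (λ x → f x ∷ g x ∷ []) (lose {P = λ z → g x ∈ f z ∷ g z ∷ []} x∈ (there (here refl)))

unique-pairs : ∀ {A : Set} (g : A → A) {xs} → Unique xs →
               (∀ {x y} → x ∈ xs → y ∈ xs → x ≢ g y) →
               (∀ {x y} → x ∈ xs → y ∈ xs → g x ≡ g y → x ≡ y) →
               Unique (pairs id g xs)
unique-pairs g {[]}     _                  _   _     = []
unique-pairs g {x ∷ xs} (x∉xs ∷ xs-unique) x≢g g-inj =
  (x≢g (here refl) (here refl) All.∷ All.tabulate x∉rest) ∷
  All.tabulate gx∉rest ∷
  unique-pairs g xs-unique (λ y∈ z∈ → x≢g (there y∈) (there z∈))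
                           (λ y∈ z∈ → g-inj (there y∈) (there z∈))
  where
  x∉rest : ∀ {y} → y ∈ pairs id g xs → x ≢ y
  x∉rest y∈ with ∈-pairs⁻ id g y∈
  ... | z , z∈ , inj₁ refl = All.lookup x∉xs z∈
  ... | z , z∈ , inj₂ refl = x≢g (here refl) (there z∈)
  gx∉rest : ∀ {y} → y ∈ pairs id g xs → g x ≢ y
  gx∉rest y∈ with ∈-pairs⁻ id g y∈
  ... | z , z∈ , inj₁ refl = λ gx≡z → x≢g (there z∈) (here refl) (sym gx≡z)
  ... | z , z∈ , inj₂ refl = λ gx≡gz → All.lookup x∉xs z∈ (g-inj (here refl) (there z∈) gx≡gz)

^-distribʳ-* : ∀ a b j → (a * b) ^ j ≡ a ^ j * b ^ j
^-distribʳ-* a b zero    = refl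
^-distribʳ-* a b (suc j) = trans (cong (a * b *_) (^-distribʳ-* a b j)) (interchange a b (a ^ j) (b ^ j))
  where
  interchange : ∀ a b x y → a * b * (x * y) ≡ a * x * (b * y)
  interchange = solve-∀

module Doubling (n : ℕ) .{{_ : NonZero n}} (1<n : 1 < n) (k : ℕ) (n∣2^e+1 : n ∣ 2 ^ suc (k + k) + 1) where

  e : ℕ
  e = suc (k + k)

  2^[e+e]≡1 : 2 ^ (e + e) ≡ 1 mod n
  2^[e+e]≡1 = begin
    2 ^ (e + e) % n ≡⟨ cong (_% n) (^-distribˡ-+-* 2 e e) ⟩
    (t * t) % n     ≡⟨ +-cancelʳ-mod t (∣⇒≡-mod n∣t*t+t (subst (n ∣_) (+-comm t 1) n∣2^e+1)) ⟩
    1 % n           ∎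
    where
    open ≡-Reasoning
    t = 2 ^ e
    factor : ∀ t → t * (t + 1) ≡ t * t + t
    factor = solve-∀
    n∣t*t+t : n ∣ t * t + t
    n∣t*t+t = subst (n ∣_) (factor t) (∣n⇒∣m*n t n∣2^e+1)

  2^[e+e]^i≡1 : ∀ i → (2 ^ (e + e)) ^ i ≡ 1 mod n
  2^[e+e]^i≡1 i = trans (^-cong-mod 2^[e+e]≡1 i) (cong (_% n) (^-zeroˡ i))

  2⊥n : Coprime 2 n
  2⊥n (d∣2 , d∣n) = ∣1⇒≡1 (∣m+n∣m⇒∣n (∣-trans d∣n n∣2^e+1) (∣m⇒∣m*n (2 ^ (k + k)) d∣2))

  -- 2 ^ e ≡ -1, so a ≡ 2 ^ e * a would make n divide the unit 2 a.
  unit≢2^e* : ∀ {a} → Coprime a n → ¬ a ≡ 2 ^ e * a mod n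
  unit≢2^e* {a} a⊥n a≡ = <⇒≢ 1<n (sym (coprime-* 2⊥n a⊥n (n∣2a , ∣-refl)))
    where
    twice : ∀ a → 2 * a ≡ a + a
    twice = solve-∀
    factor : ∀ t a → t * a + a ≡ (t + 1) * a
    factor = solve-∀
    n∣2a : n ∣ 2 * a
    n∣2a = ∣-resp-mod (trans (cong (_% n) (twice a))
                        (trans (+-cong-mod a≡ refl) (cong (_% n) (factor (2 ^ e) a))))
                      (∣m⇒∣m*n a n∣2^e+1)

  double : ℕ → ℕ
  double x = (2 * x) % n

  orbit : ℕ → ℕ → ℕ
  orbit = iterate double

  double-< : ∀ x → double x < n
  double-< x = m%n<n (2 * x) n

  coprime-double : ∀ {x} → Coprime x n → Coprime (double x) n
  coprime-double x⊥n = coprime-% (coprime-* 2⊥n x⊥n)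

  orbit-+ : ∀ x i j → orbit (orbit x i) j ≡ orbit x (i + j)
  orbit-+ x zero    j = refl
  orbit-+ x (suc i) j = orbit-+ (double x) i j

  orbit-suc : ∀ x j → orbit x (suc j) ≡ double (orbit x j)
  orbit-suc x j = trans (cong (orbit x) (+-comm 1 j)) (sym (orbit-+ x j 1))

  orbit-< : ∀ {x} j → x < n → orbit x j < n
  orbit-< zero        x<n = x<n
  orbit-< {x} (suc j) _   = orbit-< j (double-< x)

  coprime-orbit : ∀ {x} j → Coprime x n → Coprime (orbit x j) n
  coprime-orbit zero    x⊥n = x⊥n
  coprime-orbit (suc j) x⊥n = coprime-orbit j (coprime-double x⊥n)

  orbit≡2^* : ∀ x j → orbit x j ≡ 2 ^ j * x mod n
  orbit≡2^* x zero    = cong (_% n) (sym (*-identityˡ x))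
  orbit≡2^* x (suc j) = begin
    orbit (double x) j % n ≡⟨ orbit≡2^* (double x) j ⟩
    (2 ^ j * double x) % n ≡⟨ *-congˡ-mod (2 ^ j) (%-mod (2 * x)) ⟩
    (2 ^ j * (2 * x)) % n  ≡⟨ cong (_% n) (shuffle (2 ^ j) x) ⟩
    (2 ^ suc j * x) % n    ∎
    where
    open ≡-Reasoning
    shuffle : ∀ a x → a * (2 * x) ≡ 2 * a * x
    shuffle = solve-∀

  orbit-period : ∀ {x} → x < n → orbit x (e + e) ≡ x
  orbit-period {x} x<n = mod-injective (orbit-< (e + e) x<n) x<n (begin
    orbit x (e + e) % n   ≡⟨ orbit≡2^* x (e + e) ⟩
    (2 ^ (e + e) * x) % n ≡⟨ *-cong-mod 2^[e+e]≡1 refl ⟩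
    (1 * x) % n           ≡⟨ cong (_% n) (*-identityˡ x) ⟩
    x % n                 ∎)
    where open ≡-Reasoning

  -- Raising to the e-th power sends 2 ^ (even) to 1 and 2 ^ (odd) to 2 ^ e ≡ -1.
  orbit-separated : ∀ {x} → Coprime x n → ∀ i i′ → orbit x (i + i) ≢ orbit x (suc (i′ + i′))
  orbit-separated {x} x⊥n i i′ eq = unit≢2^e* (coprime-^ x⊥n e) (begin
    x ^ e % n                   ≡⟨ cong (_% n) (*-identityˡ (x ^ e)) ⟨
    (1 * x ^ e) % n             ≡⟨ *-cong-mod (sym even) refl ⟩
    ((2 ^ a) ^ e * x ^ e) % n   ≡⟨ cong (_% n) (^-distribʳ-* (2 ^ a) x e) ⟨
    (2 ^ a * x) ^ e % n         ≡⟨ ^-cong-mod 2^a*x≡2^b*x e ⟩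
    (2 ^ b * x) ^ e % n         ≡⟨ cong (_% n) (^-distribʳ-* (2 ^ b) x e) ⟩
    ((2 ^ b) ^ e * x ^ e) % n   ≡⟨ *-cong-mod odd refl ⟩
    (2 ^ e * x ^ e) % n         ∎)
    where
    open ≡-Reasoning
    a = i + i
    b = suc (i′ + i′)
    2^a*x≡2^b*x : 2 ^ a * x ≡ 2 ^ b * x mod n
    2^a*x≡2^b*x = trans (sym (orbit≡2^* x a)) (trans (cong (_% n) eq) (orbit≡2^* x b))
    even-exponent : ∀ i e → (i + i) * e ≡ (e + e) * i
    even-exponent = solve-∀
    odd-exponent : ∀ i e → suc (i + i) * e ≡ e + (e + e) * i
    odd-exponent = solve-∀
    even : (2 ^ a) ^ e ≡ 1 mod n
    even = begin
      (2 ^ a) ^ e % n       ≡⟨ cong (_% n) (^-*-assoc 2 a e) ⟩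
      2 ^ (a * e) % n       ≡⟨ cong (λ j → 2 ^ j % n) (even-exponent i e) ⟩
      2 ^ ((e + e) * i) % n ≡⟨ cong (_% n) (^-*-assoc 2 (e + e) i) ⟨
      (2 ^ (e + e)) ^ i % n ≡⟨ 2^[e+e]^i≡1 i ⟩
      1 % n                 ∎
    odd : (2 ^ b) ^ e ≡ 2 ^ e mod n
    odd = begin
      (2 ^ b) ^ e % n                  ≡⟨ cong (_% n) (^-*-assoc 2 b e) ⟩
      2 ^ (b * e) % n                  ≡⟨ cong (λ j → 2 ^ j % n) (odd-exponent i′ e) ⟩
      2 ^ (e + (e + e) * i′) % n        ≡⟨ cong (_% n) (^-distribˡ-+-* 2 e ((e + e) * i′)) ⟩
      (2 ^ e * 2 ^ ((e + e) * i′)) % n  ≡⟨ cong (λ z → (2 ^ e * z) % n) (^-*-assoc 2 (e + e) i′) ⟨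
      (2 ^ e * (2 ^ (e + e)) ^ i′) % n  ≡⟨ *-congˡ-mod (2 ^ e) (2^[e+e]^i≡1 i′) ⟩
      (2 ^ e * 1) % n                  ≡⟨ cong (_% n) (*-identityʳ (2 ^ e)) ⟩
      2 ^ e % n                        ∎

  -- suc ω is definitionally e + e, a period of every orbit.
  ω : ℕ
  ω = k + k + e

  Chosen : ℕ → Set
  Chosen x = MinAtEven (orbit x) ω

  chosen? : Decidable Chosen
  chosen? x = minAtEven? (orbit x) ω

  chosen⇒¬chosen-double : ∀ {x} → x < n → Coprime x n → Chosen x → ¬ Chosen (double x)
  chosen⇒¬chosen-double {x} x<n x⊥n =
    minAtEven⇒¬minAtEven∘suc (orbit x) ω (orbit-period x<n) (orbit-separated x⊥n)

  ¬chosen⇒chosen-double : ∀ {x} → x < n → ¬ Chosen x → Chosen (double x)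
  ¬chosen⇒chosen-double {x} x<n = ¬minAtEven⇒minAtEven∘suc (orbit x) ω (orbit-period x<n)

  ¬chosen-double⇒chosen : ∀ {x} → x < n → ¬ Chosen (double x) → Chosen x
  ¬chosen-double⇒chosen {x} x<n ¬c2x with chosen? x
  ... | yes cx = cx
  ... | no ¬cx = ⊥-elim (¬c2x (¬chosen⇒chosen-double x<n ¬cx))

  ¬chosen⇒chosen-orbit-odd : ∀ {x} → x < n → Coprime x n → ¬ Chosen x → ∀ i → Chosen (orbit x (suc (i + i)))
  ¬chosen⇒chosen-orbit-odd x<n x⊥n ¬cx zero = ¬chosen⇒chosen-double x<n ¬cx
  ¬chosen⇒chosen-orbit-odd {x} x<n x⊥n ¬cx (suc i) rewrite +-suc i i =
    ¬chosen⇒chosen-orbit-odd (double-< (double x)) (coprime-double (coprime-double x⊥n)) ¬c4x i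
    where
    ¬c4x : ¬ Chosen (double (double x))
    ¬c4x = chosen⇒¬chosen-double (double-< x) (coprime-double x⊥n) (¬chosen⇒chosen-double x<n ¬cx)

  half : ℕ → ℕ
  half x = orbit x ω

  double-half : ∀ {x} → x < n → double (half x) ≡ x
  double-half {x} x<n = trans (sym (orbit-suc x ω)) (orbit-period x<n)

  double-injective : ∀ {x y} → x < n → y < n → double x ≡ double y → x ≡ y
  double-injective {x} {y} x<n y<n 2x≡2y =
    trans (sym (orbit-period x<n)) (trans (cong half 2x≡2y) (orbit-period y<n))

  δ⁻ δ⁺ : ℕ → ℕ
  δ⁻ x = (x + n ∸ double x) % n
  δ⁺ x = (double x + n ∸ x) % n

  δ⁻≡orbit-e : ∀ x → δ⁻ x ≡ orbit x e
  δ⁻≡orbit-e x = trans (+-cancelʳ-mod (double x) (begin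
      (x + n ∸ double x + double x) % n ≡⟨ cong (_% n) (m∸n+n≡m (≤-trans (<⇒≤ (double-< x)) (m≤n+m n x))) ⟩
      (x + n) % n                       ≡⟨ [m+n]%n≡m%n x n ⟩
      x % n                             ≡⟨ %-remove-+ˡ x (∣m⇒∣m*n x n∣2^e+1) ⟨
      ((2 ^ e + 1) * x + x) % n         ≡⟨ cong (_% n) (expand (2 ^ e) x) ⟩
      (2 ^ e * x + 2 * x) % n           ≡⟨ +-cong-mod (sym (orbit≡2^* x e)) (sym (%-mod (2 * x))) ⟩
      (orbit x e + double x) % n        ∎))
    (m<n⇒m%n≡m (orbit-< (k + k) (double-< x)))
    where
    open ≡-Reasoning
    expand : ∀ t x → (t + 1) * x + x ≡ t * x + 2 * x
    expand = solve-∀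

  δ⁺≡id : ∀ {x} → x < n → δ⁺ x ≡ x
  δ⁺≡id {x} x<n = trans (+-cancelʳ-mod x (begin
      (double x + n ∸ x + x) % n ≡⟨ cong (_% n) (m∸n+n≡m (≤-trans (<⇒≤ x<n) (m≤n+m n (double x)))) ⟩
      (double x + n) % n         ≡⟨ [m+n]%n≡m%n (double x) n ⟩
      double x % n               ≡⟨ %-mod (2 * x) ⟩
      (2 * x) % n                ≡⟨ cong (_% n) (twice x) ⟩
      (x + x) % n                ∎))
    (m<n⇒m%n≡m x<n)
    where
    open ≡-Reasoning
    twice : ∀ x → 2 * x ≡ x + x
    twice = solve-∀

  unit-double : ∀ {x} → IsUnit n x → IsUnit n (double x)
  unit-double {x} (_ , x⊥n) = double-< x , coprime-double x⊥n

  unit-orbit : ∀ {x} j → IsUnit n x → IsUnit n (orbit x j)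
  unit-orbit j (x<n , x⊥n) = orbit-< j x<n , coprime-orbit j x⊥n

  ChosenUnit : ℕ → Set
  ChosenUnit x = IsUnit n x × Chosen x

  chosenUnit? : Decidable ChosenUnit
  chosenUnit? x = ((x <? n) ×-dec coprime? x n) ×-dec chosen? x

  A : List ℕ
  A = filter chosenUnit? (upTo n)

  ∈A⁻ : ∀ {x} → x ∈ A → ChosenUnit x
  ∈A⁻ x∈A = proj₂ (∈-filter⁻ chosenUnit? {xs = upTo n} x∈A)

  ∈A⁺ : ∀ {x} → ChosenUnit x → x ∈ A
  ∈A⁺ cu@((x<n , _) , _) = ∈-filter⁺ chosenUnit? (∈-upTo⁺ x<n) cu

  A-cardioidal : AreCardioidal n A
  A-cardioidal = All.tabulate λ x∈A → let (x<n , x⊥n) , _ = ∈A⁻ x∈A in positive x⊥n , x<n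
    where
    positive : ∀ {x} → Coprime x n → 0 < x
    positive {zero}  0⊥n = ⊥-elim (<⇒≢ 1<n (sym (0-coprimeTo-m⇒m≡1 0⊥n)))
    positive {suc x} _   = z<s

  A-unique : Unique (elems n A)
  A-unique = unique-pairs double (filter⁺ chosenUnit? (upTo⁺ n)) x≢2y 2x≡2y⇒x≡y
    where
    x≢2y : ∀ {x y} → x ∈ A → y ∈ A → x ≢ double y
    x≢2y x∈A y∈A refl with ∈A⁻ x∈A | ∈A⁻ y∈A
    ... | _ , c2y | (y<n , y⊥n) , cy = chosen⇒¬chosen-double y<n y⊥n cy c2y
    2x≡2y⇒x≡y : ∀ {x y} → x ∈ A → y ∈ A → double x ≡ double y → x ≡ y
    2x≡2y⇒x≡y x∈A y∈A = double-injective (proj₁ (proj₁ (∈A⁻ x∈A))) (proj₁ (proj₁ (∈A⁻ y∈A)))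

  A-covers : ∀ x → (x ∈ elems n A ⇔ IsUnit n x)
  A-covers x = mk⇔ to from
    where
    to : x ∈ elems n A → IsUnit n x
    to x∈ with ∈-pairs⁻ id double x∈
    ... | y , y∈A , inj₁ refl = proj₁ (∈A⁻ y∈A)
    ... | y , y∈A , inj₂ refl = unit-double (proj₁ (∈A⁻ y∈A))
    from : IsUnit n x → x ∈ elems n A
    from ux@(x<n , _) with chosen? x
    ... | yes cx = ∈-pairs⁺ˡ id double (∈A⁺ (ux , cx))
    ... | no ¬cx = subst (_∈ elems n A) (double-half x<n)
                     (∈-pairs⁺ʳ id double (∈A⁺ (unit-orbit ω ux , chosen-half)))
      where
      chosen-half : Chosen (half x)
      chosen-half = ¬chosen-double⇒chosen (orbit-< ω x<n)
                      (subst (λ z → ¬ Chosen z) (sym (double-half x<n)) ¬cx)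

  ΔA-covers : ∀ x → (x ∈ Δ n A ⇔ IsUnit n x)
  ΔA-covers x = mk⇔ to from
    where
    to : x ∈ Δ n A → IsUnit n x
    to x∈ with ∈-pairs⁻ δ⁻ δ⁺ x∈
    ... | y , y∈A , inj₁ refl = subst (IsUnit n) (sym (δ⁻≡orbit-e y)) (unit-orbit e (proj₁ (∈A⁻ y∈A)))
    ... | y , y∈A , inj₂ refl = let uy@(y<n , _) = proj₁ (∈A⁻ y∈A) in subst (IsUnit n) (sym (δ⁺≡id y<n)) uy
    from : IsUnit n x → x ∈ Δ n A
    from ux@(x<n , x⊥n) with chosen? x
    ... | yes cx = subst (_∈ Δ n A) (δ⁺≡id x<n) (∈-pairs⁺ʳ δ⁻ δ⁺ (∈A⁺ (ux , cx)))
    ... | no ¬cx = subst (_∈ Δ n A) (trans (δ⁻≡orbit-e (orbit x e)) (trans (orbit-+ x e e) (orbit-period x<n)))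
                     (∈-pairs⁺ˡ δ⁻ δ⁺
                       (∈A⁺ (unit-orbit e ux , ¬chosen⇒chosen-orbit-odd x<n x⊥n ¬cx k)))

lemma6 : (n : ℕ) .{{_ : NonZero n}} → InC̄₂ n →
    ∃[ A ] (IsCardioidalPartition n (IsUnit n) A
             × (∀ x → (x ∈ Δ n A ⇔ IsUnit n x)))
lemma6 n n∈C̄₂ with C̄₂⇒ n∈C̄₂
... | 1<n , _ , (k , refl) , n∣2^e+1 = A , (A-cardioidal , A-unique , A-covers) , ΔA-covers
  where open Doubling n 1<n k n∣2^e+1
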